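{- Let $w_1$ be a binary word starting with $0$ and having at least $3$ runs. A circular permutation $[\tau]$ is contained in $[IG(w_1)]$ if and only if $[\tau] = [IG(w_2)]$ for some binary word $w_2 = 0^{n_1}1^{n_2}0^{n_3}\cdots 1^{n_k}0^m$ (with all $n_i \geq 1$ and $m \geq 0$) such that $1^i0^{n_1}1^{n_2}\cdots 1^{n_k}0^{m-i}$ is a subsequence of $w_1$ for some $i \in \{0,1,\dots,m\}$.
   Context: A run of a binary word is a maximal block of consecutive equal letters; subsequences need not be contiguous. For a binary word $w=w_1\cdots w_n$ starting with $0$ with at least $3$ runs, $G(w)$ is the permutation of $[n]$ with exactly one descent such that, for each $i$, $w_i=0$ iff the value $n-i+1$ appears after the descent; if $w$ starts with $0$ and has at most $2$ runs, $G(w)=12\cdots n$. $IG(w)$ denotes the inverse permutation of $G(w)$. A circular permutation $[\pi]$ is the set of all rotations of $\pi$; $[\sigma]$ contains $[\pi]$ if some rotation of $\sigma$ has a subsequence order-isomorphic to $\pi$. -}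

module Defs where

open import Data.Bool using (Bool; true; false; not; if_then_else_)
open import Data.Nat using (ℕ; zero; suc; _∸_; _<_; _≤ᵇ_; _+_)
open import Data.List using (List; []; _∷_; _++_; length; filter; map; upTo; replicate; drop; take; concatMap)
open import Data.Product using (Σ; ∃; _×_; _,_; proj₁; proj₂)
open import Data.List.Relation.Unary.AllPairs using (AllPairs)
open import Data.List.Relation.Binary.Sublist.Propositional using (_⊆_)
open import Data.List.Relation.Binary.Permutation.Propositional using (_↭_)
open import Relation.Binary.PropositionalEquality using (_≡_)
open import Relation.Nullary.Decidable using (does)
open import Data.Nat using (_≟_)
open import Data.Bool using (T)
open import Function.Bundles using (_⇔_)

-- Binary words: List Bool, with false = letter 0 and true = letter 1.
Word : Set
Word = List Bool

StartsWith0 : Word → Set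
StartsWith0 w = Σ Word (λ rest → w ≡ false ∷ rest)

_==ᵇ_ : Bool → Bool → Bool
false ==ᵇ false = true
true  ==ᵇ true  = true
_     ==ᵇ _     = false

runs : Word → ℕ
runs [] = 0
runs (x ∷ []) = 1
runs (x ∷ y ∷ xs) = (if x ==ᵇ y then 0 else 1) + runs (y ∷ xs)

-- letter at 0-based position i (default irrelevant, never used out of range)
at : Word → ℕ → Bool
at [] _ = true
at (x ∷ xs) zero = x
at (x ∷ xs) (suc i) = at xs i

range : ℕ → List ℕ
range n = map suc (upTo n)

-- v ∈ S (value v appears after the descent) iff w_{n-v+1} = 0,
-- i.e. the letter at 0-based position n - v is 0.
afterDescent : Word → ℕ → Bool
afterDescent w v = not (at w (length w ∸ v))

-- G(w), as the list of values in one-line notation.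
-- At least 3 runs: the unique permutation with exactly one descent whose
-- values after the descent are S = {n-i+1 : w_i = 0}; it is the increasing
-- listing of [n]∖S followed by the increasing listing of S.
G : Word → List ℕ
G w = if runs w ≤ᵇ 2
      then range (length w)
      else filter (λ v → T? (not (afterDescent w v))) (range (length w))
           ++ filter (λ v → T? (afterDescent w v)) (range (length w))
  where
  open import Data.Bool.Properties using () renaming (T? to T?)

-- 1-based position of value v in the list p (0 if absent)
positionOf : ℕ → List ℕ → ℕ
positionOf v [] = 0
positionOf v (x ∷ xs) = if does (v ≟ x) then 1 else suc (positionOf v xs)

inverse : List ℕ → List ℕ
inverse p = map (λ j → positionOf j p) (range (length p))

IG : Word → List ℕ
IG w = inverse (G w)

IsPerm : List ℕ → Set
IsPerm τ = τ ↭ range (length τ)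

rotate : ℕ → List ℕ → List ℕ
rotate k xs = drop k xs ++ take k xs

SameOrder : ℕ × ℕ → ℕ × ℕ → Set
SameOrder (a , b) (c , d) = ((a < c) ⇔ (b < d)) × ((c < a) ⇔ (d < b))

OrderIso : List ℕ → List ℕ → Set
OrderIso xs ys = Σ (List (ℕ × ℕ)) λ zs →
  (map proj₁ zs ≡ xs) × (map proj₂ zs ≡ ys) × AllPairs SameOrder zs

CircContains : List ℕ → List ℕ → Set
CircContains σ π = Σ ℕ λ k → Σ (List ℕ) λ s → (s ⊆ rotate k σ) × OrderIso s π

CircEq : List ℕ → List ℕ → Set
CircEq τ σ = Σ ℕ λ k → rotate k σ ≡ τ

-- 0^{n1} 1^{n2} 0^{n3} ⋯ 0^{n_{k-1}} 1^{n_k}, given as the list of pairs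
-- (n1,n2), (n3,n4), …, (n_{k-1},n_k)  (so k is even)
blocks : List (ℕ × ℕ) → Word
blocks = concatMap (λ p → replicate (proj₁ p) false ++ replicate (proj₂ p) true)

PositiveBlocks : List (ℕ × ℕ) → Set
PositiveBlocks [] = Data.Unit.⊤ where import Data.Unit
PositiveBlocks ((a , b) ∷ ps) = (1 Data.Nat.≤ a) × (1 Data.Nat.≤ b) × PositiveBlocks ps

-- The shuffle of a word u puts the values 1, …, k on its letters 1 and k + 1, …, n on its letters 0,
-- each in increasing order; for w starting with 0, IG(w) is the shuffle of w reversed. Rotating the
-- shuffle of y x by the length of y leaves four increasing runs, from the 1s of y, the 1s of x, the 0s
-- of y and the 0s of x, which occupy consecutive blocks of values in this order. So the order pattern
-- of a subsequence depends only on the runs its entries come from, and the circular patterns of the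
-- shuffle of u are the rotations of shuffles of subwords of u (a permutation is determined by its
-- order pattern, each entry being one more than the number of smaller entries). Finally a reversed
-- subword reads 1^i 0^n₁ 1^n₂ ⋯ 1^n_k 0^j, and rotating IG(0^n₁ 1^n₂ ⋯ 1^n_k 0^(i+j)) by i gives its
-- shuffle.

{-# OPTIONS --safe #-}
module Submission where

open import Defs
open import Data.Bool using (Bool; true; false; not; T)
open import Data.Bool.Properties using (T?; not-involutive; if-cong)
open import Data.Empty using (⊥-elim)
open import Data.Nat using (ℕ; zero; suc; _+_; _∸_; _⊓_; _≤_; _<_; _≤ᵇ_; z≤n; s≤s; s≤s⁻¹; z<s; _≟_; _≤?_; _<?_)
open import Data.Nat.Properties
open import Data.List using (List; []; _∷_; _++_; [_]; length; map; filter; replicate; reverse; applyUpTo; take; drop; zipWith)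
open import Data.List.Properties
open import Data.List.Membership.Propositional using (_∈_)
open import Data.List.Relation.Unary.Any using (here; there)
open import Data.List.Relation.Unary.All as All using (All; []; _∷_)
import Data.List.Relation.Unary.All.Properties as All
open import Data.List.Relation.Unary.AllPairs using (AllPairs; []; _∷_)
import Data.List.Relation.Unary.AllPairs.Properties as AllPairs
open import Data.List.Relation.Binary.Permutation.Propositional
  using (_↭_; prep; ↭-refl; ↭-sym; ↭-reflexive; ↭-trans)
import Data.List.Relation.Binary.Permutation.Propositional.Properties as ↭
open import Data.List.Relation.Binary.Sublist.Propositional using (_⊆_; []; _∷_; _∷ʳ_)
import Data.List.Relation.Binary.Sublist.Propositional.Properties as ⊆
open import Data.Product using (Σ; _×_; _,_; proj₁; proj₂)
open import Data.Sum using (_⊎_; inj₁; inj₂; [_,_]′)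
open import Function using (_∘_; id)
open import Function.Bundles using (_⇔_; mk⇔; Equivalence)
open import Relation.Binary.PropositionalEquality hiding ([_])
open import Relation.Nullary using (yes; no)
open import Relation.Nullary.Decidable using (dec-true; dec-false)

-- Intervals and inverses

interval : ℕ → ℕ → List ℕ
interval p zero    = []
interval p (suc k) = p ∷ interval (suc p) k

length-interval : ∀ p k → length (interval p k) ≡ k
length-interval p zero    = refl
length-interval p (suc k) = cong suc (length-interval (suc p) k)

interval-+ : ∀ p a b → interval p (a + b) ≡ interval p a ++ interval (p + a) b
interval-+ p zero    b = cong (λ q → interval q b) (sym (+-identityʳ p))
interval-+ p (suc a) b = cong (p ∷_) (begin
    interval (suc p) (a + b)
  ≡⟨ interval-+ (suc p) a b ⟩
    interval (suc p) a ++ interval (suc p + a) b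
  ≡⟨ cong (λ q → interval (suc p) a ++ interval q b) (sym (+-suc p a)) ⟩
    interval (suc p) a ++ interval (p + suc a) b ∎)
  where open ≡-Reasoning

interval-∷ʳ : ∀ p k → interval p (suc k) ≡ interval p k ++ [ p + k ]
interval-∷ʳ p k = trans (cong (interval p) (+-comm 1 k)) (interval-+ p k 1)

applyUpTo≡interval : ∀ (f : ℕ → ℕ) p n → (∀ i → f i ≡ p + i) → applyUpTo f n ≡ interval p n
applyUpTo≡interval f p zero    f≗p+ = refl
applyUpTo≡interval f p (suc n) f≗p+ = cong₂ _∷_ (trans (f≗p+ 0) (+-identityʳ p))
  (applyUpTo≡interval (f ∘ suc) (suc p) n (λ i → trans (f≗p+ (suc i)) (+-suc p i)))

range≡interval : ∀ n → range n ≡ interval 1 n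
range≡interval n = trans (map-applyUpTo id suc n) (applyUpTo≡interval suc 1 n (λ _ → refl))

∈-interval⁻ : ∀ {x} p k → x ∈ interval p k → p ≤ x × x < p + k
∈-interval⁻ p (suc k) (here refl) = ≤-refl , m<m+n p (s≤s z≤n)
∈-interval⁻ {x} p (suc k) (there x∈) with ∈-interval⁻ (suc p) k x∈
... | p<x , x<p+k = <⇒≤ p<x , subst (x <_) (sym (+-suc p k)) x<p+k

All-interval⁺ : ∀ {P : ℕ → Set} p k → (∀ {x} → p ≤ x → x < p + k → P x) → All P (interval p k)
All-interval⁺ p k P-between = All.tabulate (λ x∈ → let p≤x , x<p+k = ∈-interval⁻ p k x∈ in P-between p≤x x<p+k)

map-cong-interval : ∀ {A : Set} {f g : ℕ → A} p k →
  (∀ {x} → p ≤ x → x < p + k → f x ≡ g x) → map f (interval p k) ≡ map g (interval p k)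
map-cong-interval p k f≗g = map-cong-local (All-interval⁺ p k f≗g)

positionOf-head : ∀ x xs → positionOf x (x ∷ xs) ≡ 1
positionOf-head x xs rewrite dec-true (x ≟ x) refl = refl

positionOf-++ : ∀ x xs ys → All (x ≢_) xs → positionOf x (xs ++ ys) ≡ length xs + positionOf x ys
positionOf-++ x []       ys []           = refl
positionOf-++ x (y ∷ xs) ys (x≢y ∷ x∉xs) rewrite dec-false (x ≟ y) x≢y =
  cong suc (positionOf-++ x xs ys x∉xs)

positionOf-++-∷ : ∀ x xs ys → All (x ≢_) xs → positionOf x (xs ++ x ∷ ys) ≡ suc (length xs)
positionOf-++-∷ x xs ys x∉xs = begin
    positionOf x (xs ++ x ∷ ys)
  ≡⟨ positionOf-++ x xs (x ∷ ys) x∉xs ⟩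
    length xs + positionOf x (x ∷ ys)
  ≡⟨ cong (length xs +_) (positionOf-head x ys) ⟩
    length xs + 1
  ≡⟨ +-comm (length xs) 1 ⟩
    suc (length xs) ∎
  where open ≡-Reasoning

positionOf-interval : ∀ x p k → p ≤ x → x < p + k → positionOf x (interval p k) ≡ suc (x ∸ p)
positionOf-interval x p zero p≤x x<p+0 = ⊥-elim (<⇒≱ (subst (x <_) (+-identityʳ p) x<p+0) p≤x)
positionOf-interval x p (suc k) p≤x x<p+k with x ≟ p
... | yes refl rewrite dec-true (p ≟ p) refl = cong suc (sym (n∸n≡0 p))
positionOf-interval zero    zero (suc k) z≤n x<p+k | no 0≢0 = ⊥-elim (0≢0 refl)
positionOf-interval (suc x) p (suc k) p≤x x<p+k | no x≢p rewrite dec-false (suc x ≟ p) x≢p =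
  cong suc (trans (positionOf-interval (suc x) (suc p) k p<x (subst (suc x <_) (+-suc p k) x<p+k))
                  (sym (+-∸-assoc 1 (s≤s⁻¹ p<x))))
  where
  p<x : p < suc x
  p<x = ≤∧≢⇒< p≤x (x≢p ∘ sym)

inverse-interval : ∀ n → inverse (interval 1 n) ≡ interval 1 n
inverse-interval n = begin
    map (λ j → positionOf j (interval 1 n)) (range (length (interval 1 n)))
  ≡⟨ cong (map _) (trans (range≡interval _) (cong (interval 1) (length-interval 1 n))) ⟩
    map (λ j → positionOf j (interval 1 n)) (interval 1 n)
  ≡⟨ map-cong-interval 1 n (λ 1≤x x<1+n → trans (positionOf-interval _ 1 n 1≤x x<1+n) (m+[n∸m]≡n 1≤x)) ⟩
    map id (interval 1 n)
  ≡⟨ map-id (interval 1 n) ⟩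
    interval 1 n ∎
  where open ≡-Reasoning

-- Shuffles

ones : Word → ℕ
ones []          = 0
ones (true ∷ u)  = suc (ones u)
ones (false ∷ u) = ones u

zeros : Word → ℕ
zeros []          = 0
zeros (true ∷ u)  = zeros u
zeros (false ∷ u) = suc (zeros u)

ones-++ : ∀ u v → ones (u ++ v) ≡ ones u + ones v
ones-++ []          v = refl
ones-++ (true ∷ u)  v = cong suc (ones-++ u v)
ones-++ (false ∷ u) v = ones-++ u v

ones+zeros≡length : ∀ u → ones u + zeros u ≡ length u
ones+zeros≡length []          = refl
ones+zeros≡length (true ∷ u)  = cong suc (ones+zeros≡length u)
ones+zeros≡length (false ∷ u) = trans (+-suc (ones u) (zeros u)) (cong suc (ones+zeros≡length u))

ones-replicate-true : ∀ n → ones (replicate n true) ≡ n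
ones-replicate-true zero    = refl
ones-replicate-true (suc n) = cong suc (ones-replicate-true n)

ones-replicate-false : ∀ n → ones (replicate n false) ≡ 0
ones-replicate-false zero    = refl
ones-replicate-false (suc n) = ones-replicate-false n

zeros-replicate-true : ∀ n → zeros (replicate n true) ≡ 0
zeros-replicate-true zero    = refl
zeros-replicate-true (suc n) = zeros-replicate-true n

zeros-replicate-false : ∀ n → zeros (replicate n false) ≡ n
zeros-replicate-false zero    = refl
zeros-replicate-false (suc n) = cong suc (zeros-replicate-false n)

shuffleFrom : Word → ℕ → ℕ → List ℕ
shuffleFrom []          p q = []
shuffleFrom (true ∷ u)  p q = p ∷ shuffleFrom u (suc p) q
shuffleFrom (false ∷ u) p q = q ∷ shuffleFrom u p (suc q)

shuffle : Word → List ℕ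
shuffle u = shuffleFrom u 1 (suc (ones u))

length-shuffleFrom : ∀ u p q → length (shuffleFrom u p q) ≡ length u
length-shuffleFrom []          p q = refl
length-shuffleFrom (true ∷ u)  p q = cong suc (length-shuffleFrom u (suc p) q)
length-shuffleFrom (false ∷ u) p q = cong suc (length-shuffleFrom u p (suc q))

shuffleFrom-++ : ∀ u v p q → shuffleFrom (u ++ v) p q ≡ shuffleFrom u p q ++ shuffleFrom v (p + ones u) (q + zeros u)
shuffleFrom-++ []          v p q = cong₂ (shuffleFrom v) (sym (+-identityʳ p)) (sym (+-identityʳ q))
shuffleFrom-++ (true ∷ u)  v p q = cong (p ∷_) (trans (shuffleFrom-++ u v (suc p) q)
  (cong (λ p′ → shuffleFrom u (suc p) q ++ shuffleFrom v p′ (q + zeros u)) (sym (+-suc p (ones u)))))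
shuffleFrom-++ (false ∷ u) v p q = cong (q ∷_) (trans (shuffleFrom-++ u v p (suc q))
  (cong (λ q′ → shuffleFrom u p (suc q) ++ shuffleFrom v (p + ones u) q′) (sym (+-suc q (zeros u)))))

shuffleFrom-replicate-true : ∀ n p q → shuffleFrom (replicate n true) p q ≡ interval p n
shuffleFrom-replicate-true zero    p q = refl
shuffleFrom-replicate-true (suc n) p q = cong (p ∷_) (shuffleFrom-replicate-true n (suc p) q)

shuffleFrom-replicate-false : ∀ n p q → shuffleFrom (replicate n false) p q ≡ interval q n
shuffleFrom-replicate-false zero    p q = refl
shuffleFrom-replicate-false (suc n) p q = cong (q ∷_) (shuffleFrom-replicate-false n p (suc q))

shuffle-ones++zeros : ∀ b a → shuffle (replicate b true ++ replicate a false) ≡ interval 1 (b + a)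
shuffle-ones++zeros b a = begin
    shuffleFrom (1s ++ 0s) 1 (suc (ones (1s ++ 0s)))
  ≡⟨ cong (λ n → shuffleFrom (1s ++ 0s) 1 (suc n))
       (trans (ones-++ 1s 0s) (cong₂ _+_ (ones-replicate-true b) (ones-replicate-false a))) ⟩
    shuffleFrom (1s ++ 0s) 1 (suc (b + 0))
  ≡⟨ shuffleFrom-++ 1s 0s 1 (suc (b + 0)) ⟩
    shuffleFrom 1s 1 (suc (b + 0)) ++ shuffleFrom 0s (1 + ones 1s) (suc (b + 0) + zeros 1s)
  ≡⟨ cong₂ _++_ (shuffleFrom-replicate-true b 1 _) (shuffleFrom-replicate-false a _ _) ⟩
    interval 1 b ++ interval (suc (b + 0) + zeros 1s) a
  ≡⟨ cong (λ q → interval 1 b ++ interval q a) (begin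
         suc (b + 0) + zeros 1s  ≡⟨ cong (suc (b + 0) +_) (zeros-replicate-true b) ⟩
         suc (b + 0) + 0         ≡⟨ +-identityʳ _ ⟩
         suc (b + 0)             ≡⟨ cong suc (+-identityʳ b) ⟩
         1 + b                   ∎) ⟩
    interval 1 b ++ interval (1 + b) a
  ≡⟨ sym (interval-+ 1 b a) ⟩
    interval 1 (b + a) ∎
  where
  open ≡-Reasoning
  1s = replicate b true
  0s = replicate a false

length-∷ʳ : ∀ {A : Set} (xs : List A) x → length (xs ++ [ x ]) ≡ suc (length xs)
length-∷ʳ xs x = trans (length-++ xs) (+-comm (length xs) 1)

<⇒≢-All : ∀ {x} xs → All (_< x) xs → All (x ≢_) xs
<⇒≢-All xs = All.map (λ y<x x≡y → <-irrefl (sym x≡y) y<x)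

<-All-suc : ∀ {x} xs → All (_< x) xs → All (_< suc x) xs
<-All-suc xs = All.map (λ y<x → ≤-trans y<x (n≤1+n _))

module OneDescent (f : ℕ → Bool) where

  lower : ℕ → ℕ → List ℕ
  lower p k = filter (λ v → T? (not (f v))) (interval p k)

  upper : ℕ → ℕ → List ℕ
  upper p k = filter (λ v → T? (f v)) (interval p k)

  letters : ℕ → ℕ → Word
  letters p k = map (λ v → not (f v)) (interval p k)

  length-filter-letters : ∀ (xs : List ℕ) →
    length (filter (λ v → T? (not (f v))) xs) ≡ ones (map (λ v → not (f v)) xs)
    × length (filter (λ v → T? (f v)) xs) ≡ zeros (map (λ v → not (f v)) xs)
  length-filter-letters []       = refl , refl
  length-filter-letters (x ∷ xs) with f x | length-filter-letters xs
  ... | true  | #lower , #upper = #lower , cong suc #upper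
  ... | false | #lower , #upper = cong suc #lower , #upper

  -- X and Y are the values below p in front of the lower and of the upper part of W.
  positions-lower++upper : ∀ k p (X Y W : List ℕ) → W ≡ X ++ lower p k ++ Y ++ upper p k →
    All (_< p) X → All (_< p) Y →
    map (λ v → positionOf v W) (interval p k)
    ≡ shuffleFrom (letters p k) (suc (length X)) (suc (length X + length (lower p k) + length Y))
  positions-lower++upper zero    p X Y W W≡ X<p Y<p = refl
  positions-lower++upper (suc k) p X Y W W≡ X<p Y<p with f p
  ... | false = cong₂ _∷_ position-p (trans rest (cong₂ (shuffleFrom (letters (suc p) k))
                  (cong suc (length-∷ʳ X p)) (cong (λ n → suc (n + length Y)) #X+1+#lower)))
    where
    position-p : positionOf p W ≡ suc (length X)
    position-p = trans (cong (positionOf p) W≡) (positionOf-++-∷ p X _ (<⇒≢-All X X<p))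
    rest = positions-lower++upper k (suc p) (X ++ [ p ]) Y W (trans W≡ (sym (++-assoc X [ p ] _)))
             (All.++⁺ (<-All-suc X X<p) (≤-refl ∷ [])) (<-All-suc Y Y<p)
    #X+1+#lower : length (X ++ [ p ]) + length (lower (suc p) k) ≡ length X + suc (length (lower (suc p) k))
    #X+1+#lower = trans (cong (_+ length (lower (suc p) k)) (length-∷ʳ X p)) (sym (+-suc (length X) _))
  ... | true = cong₂ _∷_ position-p (trans rest (cong (λ n → shuffleFrom (letters (suc p) k) (suc (length X)) (suc n))
                 (trans (cong (length X + length (lower (suc p) k) +_) (length-∷ʳ Y p)) (+-suc _ (length Y)))))
    where
    L = lower (suc p) k
    U = upper (suc p) k
    W≡′ : W ≡ (X ++ L ++ Y) ++ p ∷ U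
    W≡′ = trans W≡ (sym (trans (++-assoc X (L ++ Y) _) (cong (X ++_) (++-assoc L Y _))))
    p∉L : All (p ≢_) L
    p∉L = All.filter⁺ (λ v → T? (not (f v))) (All-interval⁺ (suc p) k (λ p<v _ p≡v → <-irrefl p≡v p<v))
    position-p : positionOf p W ≡ suc (length X + length L + length Y)
    position-p = begin
        positionOf p W
      ≡⟨ cong (positionOf p) W≡′ ⟩
        positionOf p ((X ++ L ++ Y) ++ p ∷ U)
      ≡⟨ positionOf-++-∷ p (X ++ L ++ Y) U (All.++⁺ (<⇒≢-All X X<p) (All.++⁺ p∉L (<⇒≢-All Y Y<p))) ⟩
        suc (length (X ++ L ++ Y))
      ≡⟨ cong suc (trans (length-++ X) (trans (cong (length X +_) (length-++ L)) (sym (+-assoc (length X) _ _)))) ⟩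
        suc (length X + length L + length Y) ∎
      where open ≡-Reasoning
    rest = positions-lower++upper k (suc p) X (Y ++ [ p ]) W (trans W≡ (cong (λ Z → X ++ L ++ Z) (sym (++-assoc Y [ p ] U))))
             (<-All-suc X X<p) (All.++⁺ (<-All-suc Y Y<p) (≤-refl ∷ []))

  inverse-lower++upper : ∀ n → inverse (lower 1 n ++ upper 1 n) ≡ shuffle (letters 1 n)
  inverse-lower++upper n = begin
      map (λ v → positionOf v W) (range (length W))
    ≡⟨ cong (map (λ v → positionOf v W)) (trans (range≡interval _) (cong (interval 1) #W)) ⟩
      map (λ v → positionOf v W) (interval 1 n)
    ≡⟨ positions-lower++upper n 1 [] [] W refl [] [] ⟩
      shuffleFrom (letters 1 n) 1 (suc (length (lower 1 n) + 0))
    ≡⟨ cong (λ m → shuffleFrom (letters 1 n) 1 (suc m)) (trans (+-identityʳ _) #lower) ⟩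
      shuffle (letters 1 n) ∎
    where
    open ≡-Reasoning
    W = lower 1 n ++ upper 1 n
    #lower = proj₁ (length-filter-letters (interval 1 n))
    #upper = proj₂ (length-filter-letters (interval 1 n))
    #W : length W ≡ n
    #W = begin
        length W
      ≡⟨ trans (length-++ (lower 1 n)) (cong₂ _+_ #lower #upper) ⟩
        ones (letters 1 n) + zeros (letters 1 n)
      ≡⟨ ones+zeros≡length (letters 1 n) ⟩
        length (letters 1 n)
      ≡⟨ trans (length-map _ (interval 1 n)) (length-interval 1 n) ⟩
        n ∎

open OneDescent using (lower; upper; letters; inverse-lower++upper)

G-twoRuns : ∀ w → (runs w ≤ᵇ 2) ≡ true → G w ≡ range (length w)
G-twoRuns w runs≤2 = if-cong runs≤2

G-oneDescent : ∀ w → (runs w ≤ᵇ 2) ≡ false →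
  G w ≡ lower (afterDescent w) 1 (length w) ++ upper (afterDescent w) 1 (length w)
G-oneDescent w runs>2 = trans (if-cong runs>2)
  (cong (λ L → filter (λ v → T? (not (afterDescent w v))) L ++ filter (λ v → T? (afterDescent w v)) L)
        (range≡interval (length w)))

map-at-reverse : ∀ w → map (λ v → at w (length w ∸ v)) (interval 1 (length w)) ≡ reverse w
map-at-reverse []      = refl
map-at-reverse (x ∷ w) = begin
    map (λ v → at (x ∷ w) (suc (length w) ∸ v)) (interval 1 (suc (length w)))
  ≡⟨ cong (map _) (interval-∷ʳ 1 (length w)) ⟩
    map (λ v → at (x ∷ w) (suc (length w) ∸ v)) (interval 1 (length w) ++ [ suc (length w) ])
  ≡⟨ map-++ _ (interval 1 (length w)) _ ⟩
    map (λ v → at (x ∷ w) (suc (length w) ∸ v)) (interval 1 (length w)) ++ [ at (x ∷ w) (length w ∸ length w) ]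
  ≡⟨ cong₂ (λ xs i → xs ++ [ at (x ∷ w) i ]) (map-cong-interval 1 (length w) drop-head) (n∸n≡0 (length w)) ⟩
    map (λ v → at w (length w ∸ v)) (interval 1 (length w)) ++ [ x ]
  ≡⟨ cong (_++ [ x ]) (map-at-reverse w) ⟩
    reverse w ++ [ x ]
  ≡⟨ sym (unfold-reverse x w) ⟩
    reverse (x ∷ w) ∎
  where
  open ≡-Reasoning
  drop-head : ∀ {v} → 1 ≤ v → v < 1 + length w → at (x ∷ w) (suc (length w) ∸ v) ≡ at w (length w ∸ v)
  drop-head {suc v} _ (s≤s v<n) = cong (at (x ∷ w)) (+-∸-assoc 1 v<n)

letters-afterDescent : ∀ w → letters (afterDescent w) 1 (length w) ≡ reverse w
letters-afterDescent w =
  trans (map-cong (λ v → not-involutive (at w (length w ∸ v))) (interval 1 (length w))) (map-at-reverse w)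

reverse-replicate : ∀ {A : Set} n (x : A) → reverse (replicate n x) ≡ replicate n x
reverse-replicate zero    x = refl
reverse-replicate (suc n) x = begin
    reverse (x ∷ replicate n x)   ≡⟨ unfold-reverse x (replicate n x) ⟩
    reverse (replicate n x) ++ [ x ] ≡⟨ cong (_++ [ x ]) (reverse-replicate n x) ⟩
    replicate n x ++ [ x ]        ≡⟨ replicate-∷ʳ n ⟩
    x ∷ replicate n x             ∎
  where
  open ≡-Reasoning
  replicate-∷ʳ : ∀ n → replicate n x ++ [ x ] ≡ x ∷ replicate n x
  replicate-∷ʳ zero    = refl
  replicate-∷ʳ (suc n) = cong (x ∷_) (replicate-∷ʳ n)

1≤runs : ∀ x r → 1 ≤ runs (x ∷ r)
1≤runs x []      = ≤-refl
1≤runs x (y ∷ r) = ≤-trans (1≤runs y r) (m≤n+m _ _)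

oneRun : ∀ r → runs (true ∷ r) ≤ 1 → Σ ℕ λ b → r ≡ replicate b true
oneRun []          _          = 0 , refl
oneRun (true ∷ r)  runs≤1     = let b , r≡ = oneRun r runs≤1 in suc b , cong (true ∷_) r≡
oneRun (false ∷ r) (s≤s runs≤0) = ⊥-elim (<-irrefl refl (≤-trans (1≤runs false r) runs≤0))

twoRuns : ∀ r → runs (false ∷ r) ≤ 2 → Σ ℕ λ a → Σ ℕ λ b → r ≡ replicate a false ++ replicate b true
twoRuns []          _          = 0 , 0 , refl
twoRuns (false ∷ r) runs≤2     = let a , b , r≡ = twoRuns r runs≤2 in suc a , b , cong (false ∷_) r≡
twoRuns (true ∷ r)  (s≤s runs≤1) = let b , r≡ = oneRun r runs≤1 in 0 , suc b , cong (true ∷_) r≡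

IG≡shuffle∘reverse : ∀ w → StartsWith0 w → IG w ≡ shuffle (reverse w)
IG≡shuffle∘reverse w (r , w≡0∷r) = by-runs (runs w ≤ᵇ 2) refl
  where
  open ≡-Reasoning
  by-runs : ∀ b → (runs w ≤ᵇ 2) ≡ b → IG w ≡ shuffle (reverse w)
  by-runs false runs>2 = begin
      inverse (G w)
    ≡⟨ cong inverse (G-oneDescent w runs>2) ⟩
      inverse (lower (afterDescent w) 1 (length w) ++ upper (afterDescent w) 1 (length w))
    ≡⟨ inverse-lower++upper (afterDescent w) (length w) ⟩
      shuffle (letters (afterDescent w) 1 (length w))
    ≡⟨ cong shuffle (letters-afterDescent w) ⟩
      shuffle (reverse w) ∎
  by-runs true runs≤2 with twoRuns r (subst (λ u → runs u ≤ 2) w≡0∷r (≤ᵇ⇒≤ (runs w) 2 (subst T (sym runs≤2) _)))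
  ... | a , b , r≡ = begin
      inverse (G w)
    ≡⟨ cong inverse (trans (G-twoRuns w runs≤2) (range≡interval (length w))) ⟩
      inverse (interval 1 (length w))
    ≡⟨ inverse-interval (length w) ⟩
      interval 1 (length w)
    ≡⟨ cong (interval 1) #w ⟩
      interval 1 (b + suc a)
    ≡⟨ sym (shuffle-ones++zeros b (suc a)) ⟩
      shuffle (replicate b true ++ replicate (suc a) false)
    ≡⟨ cong shuffle (sym reverse-w) ⟩
      shuffle (reverse w) ∎
    where
    w≡ : w ≡ replicate (suc a) false ++ replicate b true
    w≡ = trans w≡0∷r (cong (false ∷_) r≡)
    #w : length w ≡ b + suc a
    #w = trans (cong length w≡) (trans (length-++ (replicate (suc a) false))
           (trans (cong₂ _+_ (length-replicate (suc a)) (length-replicate b)) (+-comm (suc a) b)))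
    reverse-w : reverse w ≡ replicate b true ++ replicate (suc a) false
    reverse-w = trans (cong reverse w≡) (trans (reverse-++ (replicate (suc a) false) (replicate b true))
                  (cong₂ _++_ (reverse-replicate b true) (reverse-replicate (suc a) false)))

-- Rotations

rotl : List ℕ → List ℕ
rotl []       = []
rotl (x ∷ xs) = xs ++ [ x ]

rotlⁿ : ℕ → List ℕ → List ℕ
rotlⁿ zero    xs = xs
rotlⁿ (suc n) xs = rotl (rotlⁿ n xs)

rotlⁿ-+ : ∀ m n xs → rotlⁿ (m + n) xs ≡ rotlⁿ m (rotlⁿ n xs)
rotlⁿ-+ zero    n xs = refl
rotlⁿ-+ (suc m) n xs = cong rotl (rotlⁿ-+ m n xs)

rotate-zero : ∀ xs → rotate 0 xs ≡ xs
rotate-zero = ++-identityʳ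

rotate-all : ∀ k xs → length xs ≤ k → rotate k xs ≡ xs
rotate-all k xs n≤k = cong₂ _++_ (drop-all k xs n≤k) (take-all k xs n≤k)

drop-∷-take : ∀ k (xs : List ℕ) → k < length xs →
  Σ ℕ λ x → drop k xs ≡ x ∷ drop (suc k) xs × take (suc k) xs ≡ take k xs ++ [ x ]
drop-∷-take zero    (y ∷ xs) _         = y , refl , refl
drop-∷-take (suc k) (y ∷ xs) (s≤s k<n) =
  let x , drop≡ , take≡ = drop-∷-take k xs k<n in x , drop≡ , cong (y ∷_) take≡

rotl-rotate : ∀ k xs → k < length xs → rotl (rotate k xs) ≡ rotate (suc k) xs
rotl-rotate k xs k<n with drop-∷-take k xs k<n
... | x , drop≡ , take≡ = begin
    rotl (drop k xs ++ take k xs)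
  ≡⟨ cong (λ ys → rotl (ys ++ take k xs)) drop≡ ⟩
    (drop (suc k) xs ++ take k xs) ++ [ x ]
  ≡⟨ ++-assoc (drop (suc k) xs) (take k xs) [ x ] ⟩
    drop (suc k) xs ++ take k xs ++ [ x ]
  ≡⟨ cong (drop (suc k) xs ++_) (sym take≡) ⟩
    rotate (suc k) xs ∎
  where open ≡-Reasoning

rotlⁿ≡rotate : ∀ n xs → n ≤ length xs → rotlⁿ n xs ≡ rotate n xs
rotlⁿ≡rotate zero    xs _   = sym (rotate-zero xs)
rotlⁿ≡rotate (suc n) xs n<l = trans (cong rotl (rotlⁿ≡rotate n xs (<⇒≤ n<l))) (rotl-rotate n xs n<l)

rotlⁿ-length : ∀ xs → rotlⁿ (length xs) xs ≡ xs
rotlⁿ-length xs = trans (rotlⁿ≡rotate (length xs) xs ≤-refl) (rotate-all (length xs) xs ≤-refl)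

rotate-bounded : ∀ k xs → Σ ℕ λ j → j ≤ length xs × rotate k xs ≡ rotlⁿ j xs
rotate-bounded k xs with k ≤? length xs
... | yes k≤n = k , k≤n , sym (rotlⁿ≡rotate k xs k≤n)
... | no  k≰n = 0 , z≤n , rotate-all k xs (<⇒≤ (≰⇒> k≰n))

rotlⁿ-bounded : ∀ n xs → Σ ℕ λ j → j ≤ length xs × rotlⁿ n xs ≡ rotate j xs
rotlⁿ-bounded zero    xs = 0 , z≤n , sym (rotate-zero xs)
rotlⁿ-bounded (suc n) xs with rotlⁿ-bounded n xs
... | j , j≤l , rotlⁿ≡ with j <? length xs
...   | yes j<l = suc j , j<l , trans (cong rotl rotlⁿ≡) (rotl-rotate j xs j<l)
...   | no  j≮l = 1 ⊓ length xs , m⊓n≤n 1 (length xs) , (begin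
    rotl (rotlⁿ n xs)              ≡⟨ cong rotl (trans rotlⁿ≡ (rotate-all j xs (≮⇒≥ j≮l))) ⟩
    rotl xs                        ≡⟨ rotl≡rotate-1 xs ⟩
    rotate (1 ⊓ length xs) xs      ∎)
  where
  open ≡-Reasoning
  rotl≡rotate-1 : ∀ ys → rotl ys ≡ rotate (1 ⊓ length ys) ys
  rotl≡rotate-1 []       = refl
  rotl≡rotate-1 (y ∷ ys) = refl

rotate-length-++ : ∀ xs ys → rotate (length xs) (xs ++ ys) ≡ ys ++ xs
rotate-length-++ xs ys = cong₂ _++_ (drop-length-++ xs) (take-length-++ xs)
  where
  drop-length-++ : ∀ xs → drop (length xs) (xs ++ ys) ≡ ys
  drop-length-++ []       = refl
  drop-length-++ (x ∷ xs) = drop-length-++ xs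
  take-length-++ : ∀ xs → take (length xs) (xs ++ ys) ≡ xs
  take-length-++ []       = refl
  take-length-++ (x ∷ xs) = cong (x ∷_) (take-length-++ xs)

rotate-↭ : ∀ k xs → rotate k xs ↭ xs
rotate-↭ k xs = ↭-trans (↭.++-comm (drop k xs) (take k xs)) (↭-reflexive (take++drop≡id k xs))

circEq-bounded : ∀ {τ σ} → CircEq τ σ → Σ ℕ λ j → j ≤ length σ × rotate j σ ≡ τ
circEq-bounded {σ = σ} (k , rotate≡) with rotate-bounded k σ
... | j , j≤n , rotate≡rotlⁿ = j , j≤n , trans (sym (rotlⁿ≡rotate j σ j≤n)) (trans (sym rotate≡rotlⁿ) rotate≡)

circEq-sym : ∀ {τ σ} → CircEq τ σ → CircEq σ τ
circEq-sym {τ} {σ} circ with circEq-bounded circ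
... | j , j≤n , rotate≡ with rotlⁿ-bounded (length σ ∸ j) τ
...   | k , _ , rotlⁿ≡ = k , (begin
    rotate k τ                        ≡⟨ sym rotlⁿ≡ ⟩
    rotlⁿ (length σ ∸ j) τ            ≡⟨ cong (rotlⁿ (length σ ∸ j)) (trans (sym rotate≡) (sym (rotlⁿ≡rotate j σ j≤n))) ⟩
    rotlⁿ (length σ ∸ j) (rotlⁿ j σ)  ≡⟨ sym (rotlⁿ-+ (length σ ∸ j) j σ) ⟩
    rotlⁿ (length σ ∸ j + j) σ        ≡⟨ cong (λ n → rotlⁿ n σ) (m∸n+n≡m j≤n) ⟩
    rotlⁿ (length σ) σ                ≡⟨ rotlⁿ-length σ ⟩
    σ                                 ∎)
  where open ≡-Reasoning

circEq-trans : ∀ {ρ σ τ} → CircEq ρ σ → CircEq σ τ → CircEq ρ τ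
circEq-trans {ρ} {σ} {τ} (a , rotate≡ρ) (b , rotate≡σ) with rotate-bounded a σ | rotate-bounded b τ
... | a′ , _ , rotate-a | b′ , _ , rotate-b with rotlⁿ-bounded (a′ + b′) τ
...   | k , _ , rotlⁿ≡ = k , (begin
    rotate k τ              ≡⟨ sym rotlⁿ≡ ⟩
    rotlⁿ (a′ + b′) τ       ≡⟨ rotlⁿ-+ a′ b′ τ ⟩
    rotlⁿ a′ (rotlⁿ b′ τ)   ≡⟨ cong (rotlⁿ a′) (trans (sym rotate-b) rotate≡σ) ⟩
    rotlⁿ a′ σ              ≡⟨ trans (sym rotate-a) rotate≡ρ ⟩
    ρ                       ∎)
  where open ≡-Reasoning

shuffleFrom-↭ : ∀ u p q → shuffleFrom u p q ↭ interval p (ones u) ++ interval q (zeros u)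
shuffleFrom-↭ []          p q = ↭-refl
shuffleFrom-↭ (true ∷ u)  p q = prep p (shuffleFrom-↭ u (suc p) q)
shuffleFrom-↭ (false ∷ u) p q = ↭-trans (prep q (shuffleFrom-↭ u p (suc q)))
  (↭-sym (↭.shift q (interval p (ones u)) (interval (suc q) (zeros u))))

shuffle-↭ : ∀ u → shuffle u ↭ interval 1 (length u)
shuffle-↭ u = ↭-trans (shuffleFrom-↭ u 1 (suc (ones u)))
  (↭-reflexive (trans (sym (interval-+ 1 (ones u) (zeros u))) (cong (interval 1) (ones+zeros≡length u))))

rotate-shuffle : ∀ y x → rotate (length y) (shuffle (y ++ x))
  ≡ shuffleFrom x (suc (ones y)) (suc (ones (y ++ x) + zeros y)) ++ shuffleFrom y 1 (suc (ones (y ++ x)))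
rotate-shuffle y x = begin
    rotate (length y) (shuffle (y ++ x))
  ≡⟨ cong₂ rotate (sym (length-shuffleFrom y 1 q)) (shuffleFrom-++ y x 1 q) ⟩
    rotate (length (shuffleFrom y 1 q)) (shuffleFrom y 1 q ++ shuffleFrom x (suc (ones y)) (q + zeros y))
  ≡⟨ rotate-length-++ (shuffleFrom y 1 q) _ ⟩
    shuffleFrom x (suc (ones y)) (q + zeros y) ++ shuffleFrom y 1 q ∎
  where
  open ≡-Reasoning
  q = suc (ones (y ++ x))

rotate-shuffle-zeros : ∀ i y → rotate i (shuffle (replicate i false ++ y)) ≡ shuffle (y ++ replicate i true)
rotate-shuffle-zeros i y = begin
    rotate i (shuffle (0s ++ y))
  ≡⟨ cong (λ k → rotate k (shuffle (0s ++ y))) (sym (length-replicate i)) ⟩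
    rotate (length 0s) (shuffle (0s ++ y))
  ≡⟨ rotate-shuffle 0s y ⟩
    shuffleFrom y (suc (ones 0s)) (suc (ones (0s ++ y) + zeros 0s)) ++ shuffleFrom 0s 1 (suc (ones (0s ++ y)))
  ≡⟨ cong₂ (λ m n → shuffleFrom y (suc m) (suc n) ++ shuffleFrom 0s 1 (suc (ones (0s ++ y))))
       (ones-replicate-false i) (cong₂ _+_ #ones-0s++y (zeros-replicate-false i)) ⟩
    shuffleFrom y 1 (suc (ones y + i)) ++ shuffleFrom 0s 1 (suc (ones (0s ++ y)))
  ≡⟨ cong (shuffleFrom y 1 (suc (ones y + i)) ++_)
       (trans (shuffleFrom-replicate-false i 1 _) (cong (λ n → interval (suc n) i) #ones-0s++y)) ⟩
    shuffleFrom y 1 (suc (ones y + i)) ++ interval (suc (ones y)) i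
  ≡⟨ cong (λ p → shuffleFrom y 1 (suc (ones y + i)) ++ p) (sym (shuffleFrom-replicate-true i _ _)) ⟩
    shuffleFrom y 1 (suc (ones y + i)) ++ shuffleFrom 1s (1 + ones y) (suc (ones y + i) + zeros y)
  ≡⟨ sym (shuffleFrom-++ y 1s 1 (suc (ones y + i))) ⟩
    shuffleFrom (y ++ 1s) 1 (suc (ones y + i))
  ≡⟨ cong (λ n → shuffleFrom (y ++ 1s) 1 (suc n))
       (sym (trans (ones-++ y 1s) (cong (ones y +_) (ones-replicate-true i)))) ⟩
    shuffle (y ++ 1s) ∎
  where
  open ≡-Reasoning
  0s = replicate i false
  1s = replicate i true
  #ones-0s++y : ones (0s ++ y) ≡ ones y
  #ones-0s++y = trans (ones-++ 0s y) (cong (_+ ones y) (ones-replicate-false i))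

-- Order isomorphisms

rank : ℕ → List ℕ → ℕ
rank x xs = length (filter (_<? x) xs)

ranks : List ℕ → List ℕ
ranks xs = map (λ x → rank x xs) xs

rank-↭ : ∀ x {xs ys} → xs ↭ ys → rank x xs ≡ rank x ys
rank-↭ x xs↭ys = ↭.↭-length (↭.filter-↭ (_<? x) xs↭ys)

rank-interval : ∀ x p k → p ≤ x → x ≤ p + k → rank x (interval p k) ≡ x ∸ p
rank-interval x p zero    p≤x x≤p+0 rewrite ≤-antisym (≤-trans x≤p+0 (≤-reflexive (+-identityʳ p))) p≤x = sym (n∸n≡0 p)
rank-interval x p (suc k) p≤x x≤p+k with p <? x
... | yes p<x = begin
    length (filter (_<? x) (p ∷ interval (suc p) k))
  ≡⟨ cong length (filter-accept (_<? x) p<x) ⟩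
    suc (rank x (interval (suc p) k))
  ≡⟨ cong suc (rank-interval x (suc p) k p<x (≤-trans x≤p+k (≤-reflexive (+-suc p k)))) ⟩
    suc (x ∸ suc p)
  ≡⟨ sym (+-∸-assoc 1 p<x) ⟩
    x ∸ p ∎
  where open ≡-Reasoning
... | no p≮x rewrite ≤-antisym p≤x (≮⇒≥ p≮x) = begin
    length (filter (_<? x) (x ∷ interval (suc x) k))
  ≡⟨ cong length (filter-reject (_<? x) (<-irrefl refl)) ⟩
    length (filter (_<? x) (interval (suc x) k))
  ≡⟨ cong length (filter-none (_<? x) (All-interval⁺ (suc x) k (λ x<v _ v<x → <-asym x<v v<x))) ⟩
    0
  ≡⟨ sym (n∸n≡0 x) ⟩
    x ∸ x ∎
  where open ≡-Reasoning

suc-rank-perm : ∀ {τ n} → τ ↭ interval 1 n → All (λ x → suc (rank x τ) ≡ x) τ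
suc-rank-perm {τ} {n} τ↭ = All.tabulate λ {x} x∈τ →
  let 1≤x , x<1+n = ∈-interval⁻ 1 n (↭.∈-resp-↭ τ↭ x∈τ) in
  trans (cong suc (trans (rank-↭ x τ↭) (rank-interval x 1 n 1≤x (<⇒≤ x<1+n)))) (m+[n∸m]≡n 1≤x)

perm≡suc-ranks : ∀ {τ n} → τ ↭ interval 1 n → τ ≡ map suc (ranks τ)
perm≡suc-ranks {τ} τ↭ = sym (trans (sym (map-∘ τ)) (trans (map-cong-local (suc-rank-perm τ↭)) (map-id τ)))

Agree : ℕ × ℕ → ℕ × ℕ → Set
Agree p q = (proj₁ q < proj₁ p) ⇔ (proj₂ q < proj₂ p)

sameOrder⇒agree : ∀ zs → AllPairs SameOrder zs → All (λ p → All (Agree p) zs) zs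
sameOrder⇒agree []       []                    = []
sameOrder⇒agree (r ∷ rs) (r-before ∷ rs-ordered) =
  (mk⇔ (⊥-elim ∘ <-irrefl refl) (⊥-elim ∘ <-irrefl refl) ∷ All.map proj₂ r-before)
  ∷ All.zipWith (λ (r-q , q-rs) → proj₁ r-q ∷ q-rs) (r-before , sameOrder⇒agree rs rs-ordered)

rank-agree : ∀ p zs → All (Agree p) zs → rank (proj₁ p) (map proj₁ zs) ≡ rank (proj₂ p) (map proj₂ zs)
rank-agree p []       []              = refl
rank-agree p (q ∷ zs) (q~p ∷ zs~p) with proj₁ q <? proj₁ p
... | yes q₁<p₁ = trans (cong length (filter-accept (_<? proj₁ p) q₁<p₁))
                 (trans (cong suc (rank-agree p zs zs~p))
                        (sym (cong length (filter-accept (_<? proj₂ p) (Equivalence.to q~p q₁<p₁)))))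
... | no  q₁≮p₁ = trans (cong length (filter-reject (_<? proj₁ p) q₁≮p₁))
                 (trans (rank-agree p zs zs~p)
                        (sym (cong length (filter-reject (_<? proj₂ p) (q₁≮p₁ ∘ Equivalence.from q~p)))))

orderIso⇒ranks : ∀ {xs ys} → OrderIso xs ys → ranks xs ≡ ranks ys
orderIso⇒ranks (zs , refl , refl , ordered) = begin
    map (λ x → rank x (map proj₁ zs)) (map proj₁ zs)
  ≡⟨ sym (map-∘ zs) ⟩
    map (λ p → rank (proj₁ p) (map proj₁ zs)) zs
  ≡⟨ map-cong-local (All.map (λ {p} → rank-agree p zs) (sameOrder⇒agree zs ordered)) ⟩
    map (λ p → rank (proj₂ p) (map proj₂ zs)) zs
  ≡⟨ map-∘ zs ⟩
    map (λ y → rank y (map proj₂ zs)) (map proj₂ zs) ∎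
  where open ≡-Reasoning

orderIso-perm-unique : ∀ {s τ σ n m} → OrderIso s τ → OrderIso s σ →
  τ ↭ interval 1 n → σ ↭ interval 1 m → τ ≡ σ
orderIso-perm-unique {s} {τ} {σ} s≅τ s≅σ τ↭ σ↭ = begin
    τ                 ≡⟨ perm≡suc-ranks τ↭ ⟩
    map suc (ranks τ) ≡⟨ cong (map suc) (trans (sym (orderIso⇒ranks s≅τ)) (orderIso⇒ranks s≅σ)) ⟩
    map suc (ranks σ) ≡⟨ sym (perm≡suc-ranks σ↭) ⟩
    σ                 ∎
  where open ≡-Reasoning

ClassOrder : ℕ × ℕ → ℕ × ℕ → Set
ClassOrder e f = (proj₁ e ≤ proj₁ f → proj₂ e < proj₂ f) × (proj₁ f < proj₁ e → proj₂ f < proj₂ e)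

ClassOrdered : List (ℕ × ℕ) → Set
ClassOrdered = AllPairs ClassOrder

pairValues : List (ℕ × ℕ) → List (ℕ × ℕ) → List (ℕ × ℕ)
pairValues = zipWith (λ e f → proj₂ e , proj₂ f)

pairValues-proj : ∀ es fs → map proj₁ es ≡ map proj₁ fs →
  map proj₁ (pairValues es fs) ≡ map proj₂ es × map proj₂ (pairValues es fs) ≡ map proj₂ fs
pairValues-proj []       []       _   = refl , refl
pairValues-proj (e ∷ es) (f ∷ fs) es≡ =
  let ≡₁ , ≡₂ = pairValues-proj es fs (∷-injectiveʳ es≡) in cong (proj₂ e ∷_) ≡₁ , cong (proj₂ f ∷_) ≡₂

sameOrder-classOrder : ∀ {e f a b} → proj₁ e ≡ proj₁ f → proj₁ a ≡ proj₁ b →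
  ClassOrder e a → ClassOrder f b → SameOrder (proj₂ e , proj₂ f) (proj₂ a , proj₂ b)
sameOrder-classOrder {e} {f} {a} {b} refl refl (e≤a⇒ , a<e⇒) (f≤b⇒ , b<f⇒) with proj₁ e ≤? proj₁ a
... | yes e≤a = mk⇔ (λ _ → f≤b⇒ e≤a) (λ _ → e≤a⇒ e≤a)
              , mk⇔ (λ a<e → ⊥-elim (<-asym a<e (e≤a⇒ e≤a))) (λ b<f → ⊥-elim (<-asym b<f (f≤b⇒ e≤a)))
... | no  e≰a = mk⇔ (λ e<a → ⊥-elim (<-asym e<a (a<e⇒ (≰⇒> e≰a)))) (λ f<b → ⊥-elim (<-asym f<b (b<f⇒ (≰⇒> e≰a))))
              , mk⇔ (λ _ → b<f⇒ (≰⇒> e≰a)) (λ _ → a<e⇒ (≰⇒> e≰a))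

classOrdered⇒orderIso : ∀ es fs → ClassOrdered es → ClassOrdered fs → map proj₁ es ≡ map proj₁ fs →
  OrderIso (map proj₂ es) (map proj₂ fs)
classOrdered⇒orderIso es fs es-ordered fs-ordered es≡ =
  pairValues es fs , proj₁ (pairValues-proj es fs es≡) , proj₂ (pairValues-proj es fs es≡) ,
  sameOrder-pairs es fs es≡ es-ordered fs-ordered
  where
  sameOrder-heads : ∀ {e f} es fs → proj₁ e ≡ proj₁ f → map proj₁ es ≡ map proj₁ fs →
    All (ClassOrder e) es → All (ClassOrder f) fs → All (SameOrder (proj₂ e , proj₂ f)) (pairValues es fs)
  sameOrder-heads []       []       _ _   []           []           = []
  sameOrder-heads (a ∷ es) (b ∷ fs) e≡f es≡ (e-a ∷ e-es) (f-b ∷ f-fs) =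
    sameOrder-classOrder e≡f (∷-injectiveˡ es≡) e-a f-b ∷ sameOrder-heads es fs e≡f (∷-injectiveʳ es≡) e-es f-fs
  sameOrder-pairs : ∀ es fs → map proj₁ es ≡ map proj₁ fs →
    ClassOrdered es → ClassOrdered fs → AllPairs SameOrder (pairValues es fs)
  sameOrder-pairs []       []       _   []           []           = []
  sameOrder-pairs (e ∷ es) (f ∷ fs) es≡ (e-es ∷ es-o) (f-fs ∷ fs-o) =
    sameOrder-heads es fs (∷-injectiveˡ es≡) (∷-injectiveʳ es≡) e-es f-fs
    ∷ sameOrder-pairs es fs (∷-injectiveʳ es≡) es-o fs-o

start : (ℕ → ℕ) → ℕ → ℕ
start s zero    = 1
start s (suc c) = start s c + s c

start-mono : ∀ s {a b} → a ≤ b → start s a ≤ start s b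
start-mono s {a} {zero}  z≤n = ≤-refl
start-mono s {a} {suc b} a≤1+b with a ≤? b
... | yes a≤b = ≤-trans (start-mono s a≤b) (m≤m+n _ _)
... | no  a≰b = ≤-reflexive (cong (start s) (≤-antisym a≤1+b (≰⇒> a≰b)))

InBlock : (ℕ → ℕ) → ℕ × ℕ → Set
InBlock s e = start s (proj₁ e) ≤ proj₂ e × proj₂ e < start s (suc (proj₁ e))

IncreasingInClass : ℕ × ℕ → ℕ × ℕ → Set
IncreasingInClass e f = proj₁ e ≡ proj₁ f → proj₂ e < proj₂ f

classOrdered-blocks : ∀ s es → AllPairs IncreasingInClass es → All (InBlock s) es → ClassOrdered es
classOrdered-blocks s []       []           []             = []
classOrdered-blocks s (e ∷ es) (e-es ∷ es-inc) (e-in ∷ es-in) =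
  All.zipWith (λ (e-f , f-in) → classOrder e-f e-in f-in) (e-es , es-in) ∷ classOrdered-blocks s es es-inc es-in
  where
  classOrder : ∀ {f} → IncreasingInClass e f → InBlock s e → InBlock s f → ClassOrder e f
  classOrder {f} e-f (e≥ , e<) (f≥ , f<) = e≤f⇒ , f<e⇒
    where
    e≤f⇒ : proj₁ e ≤ proj₁ f → proj₂ e < proj₂ f
    e≤f⇒ e≤f with proj₁ e ≟ proj₁ f
    ... | yes e≡f = e-f e≡f
    ... | no  e≢f = <-≤-trans e< (≤-trans (start-mono s (≤∧≢⇒< e≤f e≢f)) f≥)
    f<e⇒ : proj₁ f < proj₁ e → proj₂ f < proj₂ e
    f<e⇒ f<e = <-≤-trans f< (≤-trans (start-mono s f<e) e≥)

-- Circular patterns of shuffles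

classOf : ℕ → ℕ → Bool → ℕ
classOf c₁ c₀ true  = c₁
classOf c₁ c₀ false = c₀

labelledFrom : Word → ℕ → ℕ → ℕ → ℕ → List (ℕ × ℕ)
labelledFrom []          p q c₁ c₀ = []
labelledFrom (true ∷ u)  p q c₁ c₀ = (c₁ , p) ∷ labelledFrom u (suc p) q c₁ c₀
labelledFrom (false ∷ u) p q c₁ c₀ = (c₀ , q) ∷ labelledFrom u p (suc q) c₁ c₀

module _ (c₁ c₀ : ℕ) where

  map-proj₂-labelledFrom : ∀ u p q → map proj₂ (labelledFrom u p q c₁ c₀) ≡ shuffleFrom u p q
  map-proj₂-labelledFrom []          p q = refl
  map-proj₂-labelledFrom (true ∷ u)  p q = cong (p ∷_) (map-proj₂-labelledFrom u (suc p) q)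
  map-proj₂-labelledFrom (false ∷ u) p q = cong (q ∷_) (map-proj₂-labelledFrom u p (suc q))

  map-proj₁-labelledFrom : ∀ u p q → map proj₁ (labelledFrom u p q c₁ c₀) ≡ map (classOf c₁ c₀) u
  map-proj₁-labelledFrom []          p q = refl
  map-proj₁-labelledFrom (true ∷ u)  p q = cong (c₁ ∷_) (map-proj₁-labelledFrom u (suc p) q)
  map-proj₁-labelledFrom (false ∷ u) p q = cong (c₀ ∷_) (map-proj₁-labelledFrom u p (suc q))

  LabelBound : Word → ℕ → ℕ → ℕ × ℕ → Set
  LabelBound u p q e = (proj₁ e ≡ c₁ × p ≤ proj₂ e × proj₂ e < p + ones u)
                     ⊎ (proj₁ e ≡ c₀ × q ≤ proj₂ e × proj₂ e < q + zeros u)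

  labelledFrom-bounds : ∀ u p q → All (LabelBound u p q) (labelledFrom u p q c₁ c₀)
  labelledFrom-bounds []          p q = []
  labelledFrom-bounds (true ∷ u)  p q = inj₁ (refl , ≤-refl , m<m+n p z<s)
    ∷ All.map [ (λ (≡c , p<v , v<) → inj₁ (≡c , <⇒≤ p<v , ≤-trans v< (≤-reflexive (sym (+-suc p (ones u)))))) , inj₂ ]′
              (labelledFrom-bounds u (suc p) q)
  labelledFrom-bounds (false ∷ u) p q = inj₂ (refl , ≤-refl , m<m+n q z<s)
    ∷ All.map [ inj₁ , (λ (≡c , q<v , v<) → inj₂ (≡c , <⇒≤ q<v , ≤-trans v< (≤-reflexive (sym (+-suc q (zeros u)))))) ]′
              (labelledFrom-bounds u p (suc q))

  labelledFrom-increasing : c₁ ≢ c₀ → ∀ u p q → AllPairs IncreasingInClass (labelledFrom u p q c₁ c₀)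
  labelledFrom-increasing c₁≢c₀ []          p q = []
  labelledFrom-increasing c₁≢c₀ (true ∷ u)  p q =
    All.map [ (λ (_ , p<v , _) _ → p<v) , (λ (≡c₀ , _) c₁≡ → ⊥-elim (c₁≢c₀ (trans c₁≡ ≡c₀))) ]′
            (labelledFrom-bounds u (suc p) q)
    ∷ labelledFrom-increasing c₁≢c₀ u (suc p) q
  labelledFrom-increasing c₁≢c₀ (false ∷ u) p q =
    All.map [ (λ (≡c₁ , _) c₀≡ → ⊥-elim (c₁≢c₀ (sym (trans c₀≡ ≡c₁)))) , (λ (_ , q<v , _) _ → q<v) ]′
            (labelledFrom-bounds u p (suc q))
    ∷ labelledFrom-increasing c₁≢c₀ u p (suc q)

-- The entries of rotate (length y) (shuffle (y ++ x)), labelled by the classes 0, 1, 2, 3 for the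
-- ones of y, the ones of x, the zeros of y and the zeros of x; the classes take consecutive blocks of values.
labelledRotation : Word → Word → List (ℕ × ℕ)
labelledRotation x y = labelledFrom x (suc (ones y)) (suc (ones y + ones x + zeros y)) 1 3
                    ++ labelledFrom y 1 (suc (ones y + ones x)) 0 2

classSizes : Word → Word → ℕ → ℕ
classSizes x y 0 = ones y
classSizes x y 1 = ones x
classSizes x y 2 = zeros y
classSizes x y _ = zeros x

labelledRotation-classOrdered : ∀ x y → ClassOrdered (labelledRotation x y)
labelledRotation-classOrdered x y = classOrdered-blocks (classSizes x y) (labelledRotation x y)
  (AllPairs.++⁺ (labelledFrom-increasing 1 3 (λ ()) x _ _) (labelledFrom-increasing 0 2 (λ ()) y _ _)
     (All.map (λ e-x → All.map (different-classes e-x) (labelledFrom-bounds 0 2 y _ _)) (labelledFrom-bounds 1 3 x _ _)))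
  (All.++⁺ (All.map [ (λ { (refl , in-block) → in-block }) , (λ { (refl , in-block) → in-block }) ]′ (labelledFrom-bounds 1 3 x _ _))
           (All.map [ (λ { (refl , in-block) → in-block }) , (λ { (refl , in-block) → in-block }) ]′ (labelledFrom-bounds 0 2 y _ _)))
  where
  different-classes : ∀ {e f} → LabelBound 1 3 x (suc (ones y)) (suc (ones y + ones x + zeros y)) e →
    LabelBound 0 2 y 1 (suc (ones y + ones x)) f → IncreasingInClass e f
  different-classes (inj₁ (refl , _)) (inj₁ (refl , _)) ()
  different-classes (inj₁ (refl , _)) (inj₂ (refl , _)) ()
  different-classes (inj₂ (refl , _)) (inj₁ (refl , _)) ()
  different-classes (inj₂ (refl , _)) (inj₂ (refl , _)) ()

labelledRotation-classes : ∀ x y → map proj₁ (labelledRotation x y) ≡ map (classOf 1 3) x ++ map (classOf 0 2) y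
labelledRotation-classes x y = trans (map-++ proj₁ (labelledFrom x _ _ 1 3) _)
  (cong₂ _++_ (map-proj₁-labelledFrom 1 3 x _ _) (map-proj₁-labelledFrom 0 2 y _ _))

labelledRotation-values : ∀ x y → map proj₂ (labelledRotation x y) ≡ rotate (length y) (shuffle (y ++ x))
labelledRotation-values x y = begin
    map proj₂ (labelledRotation x y)
  ≡⟨ map-++ proj₂ (labelledFrom x _ _ 1 3) _ ⟩
    map proj₂ (labelledFrom x _ _ 1 3) ++ map proj₂ (labelledFrom y _ _ 0 2)
  ≡⟨ cong₂ _++_ (map-proj₂-labelledFrom 1 3 x _ _) (map-proj₂-labelledFrom 0 2 y _ _) ⟩
    shuffleFrom x (suc (ones y)) (suc (ones y + ones x + zeros y)) ++ shuffleFrom y 1 (suc (ones y + ones x))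
  ≡⟨ cong (λ n → shuffleFrom x (suc (ones y)) (suc (n + zeros y)) ++ shuffleFrom y 1 (suc n)) (sym (ones-++ y x)) ⟩
    shuffleFrom x (suc (ones y)) (suc (ones (y ++ x) + zeros y)) ++ shuffleFrom y 1 (suc (ones (y ++ x)))
  ≡⟨ sym (rotate-shuffle y x) ⟩
    rotate (length y) (shuffle (y ++ x)) ∎
  where open ≡-Reasoning

module _ {A : Set} where

  ⊆-map⁻ : ∀ {B : Set} (f : A → B) xs {zs} → zs ⊆ map f xs → Σ (List A) λ ys → ys ⊆ xs × zs ≡ map f ys
  ⊆-map⁻ f []       []          = [] , [] , refl
  ⊆-map⁻ f (x ∷ xs) (_ ∷ʳ zs⊆)  = let ys , ys⊆ , zs≡ = ⊆-map⁻ f xs zs⊆ in ys , x ∷ʳ ys⊆ , zs≡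
  ⊆-map⁻ f (x ∷ xs) (refl ∷ zs⊆) = let ys , ys⊆ , zs≡ = ⊆-map⁻ f xs zs⊆ in x ∷ ys , refl ∷ ys⊆ , cong (f x ∷_) zs≡

  ⊆-++⁻ : ∀ (xs ys : List A) {zs} → zs ⊆ xs ++ ys →
    Σ (List A) λ zs₁ → Σ (List A) λ zs₂ → zs ≡ zs₁ ++ zs₂ × zs₁ ⊆ xs × zs₂ ⊆ ys
  ⊆-++⁻ []       ys zs⊆           = [] , _ , refl , [] , zs⊆
  ⊆-++⁻ (x ∷ xs) ys (_ ∷ʳ zs⊆)    = let zs₁ , zs₂ , zs≡ , ⊆xs , ⊆ys = ⊆-++⁻ xs ys zs⊆ in
                                    zs₁ , zs₂ , zs≡ , x ∷ʳ ⊆xs , ⊆ys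
  ⊆-++⁻ (x ∷ xs) ys (refl ∷ zs⊆)  = let zs₁ , zs₂ , zs≡ , ⊆xs , ⊆ys = ⊆-++⁻ xs ys zs⊆ in
                                    x ∷ zs₁ , zs₂ , cong (x ∷_) zs≡ , refl ∷ ⊆xs , ⊆ys

  ++-⊆⁻ : ∀ (xs ys : List A) {zs} → xs ++ ys ⊆ zs →
    Σ (List A) λ zs₁ → Σ (List A) λ zs₂ → zs ≡ zs₁ ++ zs₂ × xs ⊆ zs₁ × ys ⊆ zs₂
  ++-⊆⁻ []       ys {zs} ys⊆       = [] , zs , refl , [] , ys⊆
  ++-⊆⁻ (x ∷ xs) ys (z ∷ʳ ⊆zs)     = let zs₁ , zs₂ , zs≡ , xs⊆ , ys⊆ = ++-⊆⁻ (x ∷ xs) ys ⊆zs in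
                                     z ∷ zs₁ , zs₂ , cong (z ∷_) zs≡ , z ∷ʳ xs⊆ , ys⊆
  ++-⊆⁻ (x ∷ xs) ys (refl ∷ ⊆zs)   = let zs₁ , zs₂ , zs≡ , xs⊆ , ys⊆ = ++-⊆⁻ xs ys ⊆zs in
                                     x ∷ zs₁ , zs₂ , cong (x ∷_) zs≡ , refl ∷ xs⊆ , ys⊆

  AllPairs-resp-⊇ : ∀ {R : A → A → Set} {xs ys} → xs ⊆ ys → AllPairs R ys → AllPairs R xs
  AllPairs-resp-⊇ []          []              = []
  AllPairs-resp-⊇ (_ ∷ʳ xs⊆)  (_ ∷ ys-pairs)  = AllPairs-resp-⊇ xs⊆ ys-pairs
  AllPairs-resp-⊇ (refl ∷ xs⊆) (y-ys ∷ ys-pairs) = ⊆.All-resp-⊆ xs⊆ y-ys ∷ AllPairs-resp-⊇ xs⊆ ys-pairs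

rotate-shuffle≡labelledRotation : ∀ u j → j ≤ length u →
  rotate j (shuffle u) ≡ map proj₂ (labelledRotation (drop j u) (take j u))
rotate-shuffle≡labelledRotation u j j≤n = begin
    rotate j (shuffle u)
  ≡⟨ cong₂ (λ k v → rotate k (shuffle v)) (sym #take) (sym (take++drop≡id j u)) ⟩
    rotate (length (take j u)) (shuffle (take j u ++ drop j u))
  ≡⟨ sym (labelledRotation-values (drop j u) (take j u)) ⟩
    map proj₂ (labelledRotation (drop j u) (take j u)) ∎
  where
  open ≡-Reasoning
  #take : length (take j u) ≡ j
  #take = trans (length-take j u) (m≤n⇒m⊓n≡m j≤n)

sublist-rotate-shuffle : ∀ u k s → s ⊆ rotate k (shuffle u) →
  Σ Word λ z → z ⊆ u × Σ ℕ λ j → OrderIso s (rotate j (shuffle z))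
sublist-rotate-shuffle u k s s⊆ =
  let j , j≤n , rotate≡ = circEq-bounded {σ = shuffle u} (k , refl)
      es , es⊆ , s≡ = ⊆-map⁻ proj₂ (labelledRotation (drop j u) (take j u))
        (subst (s ⊆_) (trans (sym rotate≡) (rotate-shuffle≡labelledRotation u j (≤-trans j≤n (≤-reflexive (length-shuffleFrom u _ _))))) s⊆)
      cs₁ , cs₂ , cs≡ , cs₁⊆ , cs₂⊆ = ⊆-++⁻ (map (classOf 1 3) (drop j u)) (map (classOf 0 2) (take j u))
        (subst (map proj₁ es ⊆_) (labelledRotation-classes (drop j u) (take j u)) (⊆.map⁺ proj₁ es⊆))
      x , x⊆ , cs₁≡ = ⊆-map⁻ (classOf 1 3) (drop j u) cs₁⊆
      y , y⊆ , cs₂≡ = ⊆-map⁻ (classOf 0 2) (take j u) cs₂⊆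
  in y ++ x , subst (y ++ x ⊆_) (take++drop≡id j u) (⊆.++⁺ y⊆ x⊆) , length y ,
     subst₂ OrderIso (sym s≡) (labelledRotation-values x y)
       (classOrdered⇒orderIso es (labelledRotation x y)
         (AllPairs-resp-⊇ es⊆ (labelledRotation-classOrdered (drop j u) (take j u)))
         (labelledRotation-classOrdered x y)
         (trans cs≡ (trans (cong₂ _++_ cs₁≡ cs₂≡) (sym (labelledRotation-classes x y)))))

circContains-shuffle⁻ : ∀ {u τ} → τ ↭ interval 1 (length τ) → CircContains (shuffle u) τ →
  Σ Word λ z → z ⊆ u × CircEq τ (shuffle z)
circContains-shuffle⁻ {u} τ↭ (k , s , s⊆ , s≅τ) =
  let z , z⊆u , j , s≅rotation = sublist-rotate-shuffle u k s s⊆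
  in z , z⊆u , j , orderIso-perm-unique s≅rotation s≅τ (↭-trans (rotate-↭ j (shuffle z)) (shuffle-↭ z)) τ↭

circContains-shuffle⁺ : ∀ {u z π} → z ⊆ u → CircEq π (shuffle z) → CircContains (shuffle u) π
circContains-shuffle⁺ {u} {z} {π} z⊆u circ =
  let j , j≤n , rotate≡π = circEq-bounded circ
      u₁ , u₂ , u≡ , take⊆ , drop⊆ = ++-⊆⁻ (take j z) (drop j z) (subst (_⊆ u) (sym (take++drop≡id j z)) z⊆u)
      es , es⊆ , classes≡ = ⊆-map⁻ proj₁ (labelledRotation u₂ u₁)
        (subst (map (classOf 1 3) (drop j z) ++ map (classOf 0 2) (take j z) ⊆_) (sym (labelledRotation-classes u₂ u₁))
           (⊆.++⁺ (⊆.map⁺ (classOf 1 3) drop⊆) (⊆.map⁺ (classOf 0 2) take⊆)))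
      rotate≡labelled = rotate-shuffle≡labelledRotation z j (≤-trans j≤n (≤-reflexive (length-shuffleFrom z _ _)))
  in length u₁ , map proj₂ es ,
     subst (map proj₂ es ⊆_) (trans (labelledRotation-values u₂ u₁) (cong (λ v → rotate (length u₁) (shuffle v)) (sym u≡)))
       (⊆.map⁺ proj₂ es⊆) ,
     subst (OrderIso (map proj₂ es)) (trans (sym rotate≡labelled) rotate≡π)
       (classOrdered⇒orderIso es (labelledRotation (drop j z) (take j z))
         (AllPairs-resp-⊇ es⊆ (labelledRotation-classOrdered u₂ u₁))
         (labelledRotation-classOrdered (drop j z) (take j z))
         (trans (sym classes≡) (sym (labelledRotation-classes (drop j z) (take j z)))))

-- Block words

replicate-+ : ∀ {A : Set} m n (x : A) → replicate (m + n) x ≡ replicate m x ++ replicate n x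
replicate-+ zero    n x = refl
replicate-+ (suc m) n x = cong (x ∷_) (replicate-+ m n x)

decompose : ∀ v → Σ (List (ℕ × ℕ)) λ ns → Σ ℕ λ i → Σ ℕ λ j →
  PositiveBlocks ns × v ≡ replicate i true ++ blocks ns ++ replicate j false
decompose []          = [] , 0 , 0 , _ , refl
decompose (true ∷ v)  with decompose v
... | ns , i , j , positive , v≡ = ns , suc i , j , positive , cong (true ∷_) v≡
decompose (false ∷ v) with decompose v
... | []                , zero  , j , positive , v≡ = [] , 0 , suc j , _ , cong (false ∷_) v≡
... | (a , c) ∷ ns      , zero  , j , (_ , 1≤c , positive) , v≡ =
  (suc a , c) ∷ ns , 0 , j , (s≤s z≤n , 1≤c , positive) , cong (false ∷_) v≡
... | ns                , suc i , j , positive , v≡ =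
  (1 , suc i) ∷ ns , 0 , j , (s≤s z≤n , s≤s z≤n , positive) ,
  cong (false ∷_) (trans v≡ (sym (++-assoc (replicate (suc i) true) (blocks ns) _)))

startsWith0-blocks : ∀ ns i j → PositiveBlocks ns → 0 < length (replicate i true ++ blocks ns ++ replicate j false) →
  StartsWith0 (blocks ns ++ replicate (i + j) false)
startsWith0-blocks ((suc a , c) ∷ ns) i       j       _ _ = _ , refl
startsWith0-blocks []                 (suc i) j       _ _ = _ , refl
startsWith0-blocks []                 zero    (suc j) _ _ = _ , refl


rotate-IG-blocks : ∀ b i j → StartsWith0 (b ++ replicate (i + j) false) →
  rotate i (IG (b ++ replicate (i + j) false)) ≡ shuffle (reverse (replicate i true ++ b ++ replicate j false))
rotate-IG-blocks b i j starts0 = begin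
    rotate i (IG (b ++ replicate (i + j) false))
  ≡⟨ cong (rotate i) (IG≡shuffle∘reverse (b ++ replicate (i + j) false) starts0) ⟩
    rotate i (shuffle (reverse (b ++ replicate (i + j) false)))
  ≡⟨ cong (λ v → rotate i (shuffle v)) (begin
      reverse (b ++ replicate (i + j) false)
    ≡⟨ reverse-++ b (replicate (i + j) false) ⟩
      reverse (replicate (i + j) false) ++ reverse b
    ≡⟨ cong (_++ reverse b) (trans (reverse-replicate (i + j) false) (replicate-+ i j false)) ⟩
      (replicate i false ++ replicate j false) ++ reverse b
    ≡⟨ ++-assoc (replicate i false) (replicate j false) (reverse b) ⟩
      replicate i false ++ replicate j false ++ reverse b ∎) ⟩
    rotate i (shuffle (replicate i false ++ replicate j false ++ reverse b))
  ≡⟨ rotate-shuffle-zeros i (replicate j false ++ reverse b) ⟩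
    shuffle ((replicate j false ++ reverse b) ++ replicate i true)
  ≡⟨ cong shuffle (begin
      (replicate j false ++ reverse b) ++ replicate i true
    ≡⟨ cong₂ (λ zs ys → (zs ++ reverse b) ++ ys) (sym (reverse-replicate j false)) (sym (reverse-replicate i true)) ⟩
      (reverse (replicate j false) ++ reverse b) ++ reverse (replicate i true)
    ≡⟨ cong (_++ reverse (replicate i true)) (sym (reverse-++ b (replicate j false))) ⟩
      reverse (b ++ replicate j false) ++ reverse (replicate i true)
    ≡⟨ sym (reverse-++ (replicate i true) (b ++ replicate j false)) ⟩
      reverse (replicate i true ++ b ++ replicate j false) ∎) ⟩
    shuffle (reverse (replicate i true ++ b ++ replicate j false)) ∎
  where open ≡-Reasoning

circEq-length : ∀ {τ σ} → CircEq τ σ → length τ ≡ length σ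
circEq-length {σ = σ} (k , refl) = ↭.↭-length (rotate-↭ k σ)

BlockPattern : Word → List ℕ → Set
BlockPattern w₁ τ = Σ (List (ℕ × ℕ)) (λ ns → Σ ℕ (λ m →
    PositiveBlocks ns
    × StartsWith0 (blocks ns ++ replicate m false)
    × CircEq τ (IG (blocks ns ++ replicate m false))
    × Σ ℕ (λ i → (i ≤ m)
    × ((replicate i true ++ blocks ns ++ replicate (m ∸ i) false) ⊆ w₁))))

blockPattern⁺ : ∀ {w₁ τ z} → z ⊆ reverse w₁ → 0 < length z → CircEq τ (shuffle z) → BlockPattern w₁ τ
blockPattern⁺ {w₁} {τ} {z} z⊆ 0<|z| circ =
  let ns , i , j , positive , reverse-z≡ = decompose (reverse z)
      v = replicate i true ++ blocks ns ++ replicate j false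
      z≡ : z ≡ reverse v
      z≡ = trans (sym (reverse-involutive z)) (cong reverse reverse-z≡)
      starts0 = startsWith0-blocks ns i j positive
        (subst (λ u → 0 < length u) reverse-z≡ (subst (0 <_) (sym (length-reverse z)) 0<|z|))
      v⊆ : v ⊆ w₁
      v⊆ = subst₂ _⊆_ reverse-z≡ (reverse-involutive w₁) (⊆.reverse⁺ z⊆)
  in ns , i + j , positive , starts0 ,
     circEq-trans circ (i , trans (rotate-IG-blocks (blocks ns) i j starts0) (cong shuffle (sym z≡))) ,
     i , m≤m+n i j ,
     subst (λ k → replicate i true ++ blocks ns ++ replicate k false ⊆ w₁) (sym (m+n∸m≡n i j)) v⊆

blockPattern⁻ : ∀ {w₁ τ} → BlockPattern w₁ τ → Σ Word λ z → z ⊆ reverse w₁ × CircEq τ (shuffle z)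
blockPattern⁻ {w₁} {τ} (ns , m , _ , starts0 , circ , i , i≤m , v⊆) =
  reverse v , ⊆.reverse⁺ v⊆ , circEq-trans circ (circEq-sym (i , rotate-IG))
  where
  v = replicate i true ++ blocks ns ++ replicate (m ∸ i) false
  rotate-IG : rotate i (IG (blocks ns ++ replicate m false)) ≡ shuffle (reverse v)
  rotate-IG = subst (λ k → StartsWith0 (blocks ns ++ replicate k false) →
                           rotate i (IG (blocks ns ++ replicate k false)) ≡ shuffle (reverse v))
                    (m+[n∸m]≡n i≤m) (rotate-IG-blocks (blocks ns) i (m ∸ i)) starts0

theorem5p12 : (w₁ : Word) → StartsWith0 w₁ → 3 ≤ runs w₁ →
    (τ : List ℕ) → IsPerm τ → 1 ≤ length τ →
    CircContains (IG w₁) τ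
    ⇔ Σ (List (ℕ × ℕ)) (λ ns → Σ ℕ (λ m →
        PositiveBlocks ns
        × StartsWith0 (blocks ns ++ replicate m false)
        × CircEq τ (IG (blocks ns ++ replicate m false))
        × Σ ℕ (λ i → (i ≤ m)
            × ((replicate i true ++ blocks ns ++ replicate (m ∸ i) false) ⊆ w₁))))
theorem5p12 w₁ w₁-starts0 _ τ τ-perm 1≤|τ| = mk⇔
  (λ contains →
    let z , z⊆ , circ = circContains-shuffle⁻ τ↭ (subst (λ σ → CircContains σ τ) IG≡ contains)
        0<|z| = subst (0 <_) (trans (circEq-length circ) (length-shuffleFrom z _ _)) 1≤|τ|
    in blockPattern⁺ z⊆ 0<|z| circ)
  (λ block-pattern →
    let z , z⊆ , circ = blockPattern⁻ block-pattern
    in subst (λ σ → CircContains σ τ) (sym IG≡) (circContains-shuffle⁺ z⊆ circ))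
  where
  IG≡ = IG≡shuffle∘reverse w₁ w₁-starts0
  τ↭ = subst (τ ↭_) (range≡interval (length τ)) τ-perm
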